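{- Let $p$ be a prime, $q=p^m$, $1\le r<p$, and write $\mathbb{F}_q^*=\{\alpha_1,\dots,\alpha_{q-1}\}$. Let $\mathcal{G}=(\mathbb{F}_q[T]/(T^{r+1}))^*/\mathbb{F}_q^*$, an elementary abelian $p$-group of order $q^r$, viewed as an $\mathbb{F}_p$-vector space of dimension $rm$. For $I=\{i_1,\dots,i_t\}\subseteq\{1,\dots,q-1\}$, the $\mathbb{F}_p$-subspace of $\mathcal{G}$ spanned by the classes of $1+\alpha_iT$, $i\in I$, has $\mathbb{F}_p$-dimension $rm$ if and only if the matrix $$G_I=\begin{pmatrix}\alpha_{i_1}&\alpha_{i_2}&\cdots&\alpha_{i_t}\\ \alpha_{i_1}^2&\alpha_{i_2}^2&\cdots&\alpha_{i_t}^2\\ \vdots&\vdots&&\vdots\\ \alpha_{i_1}^r&\alpha_{i_2}^r&\cdots&\alpha_{i_t}^r\end{pmatrix}\in\mathbb{F}_p^{rm\times t}$$ has rank $rm$ over $\mathbb{F}_p$, where each entry $\alpha_i^k$ is viewed as a column vector in $\mathbb{F}_p^m$ via a fixed $\mathbb{F}_p$-basis of $\mathbb{F}_q$.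
   Context: The group operation of $\mathcal{G}$ is multiplication modulo $T^{r+1}$ (modulo nonzero constants); since every nonidentity element has order $p$, it is an $\mathbb{F}_p$-vector space with "addition" being multiplication and scalar multiplication by $u\in\mathbb{F}_p$ being the $u$-th power. -}

module Defs where

open import Data.Nat using (ℕ; zero; suc; _+_; _*_; _∸_; NonZero)
open import Data.Nat.DivMod using (_mod_)
open import Data.Fin using (Fin; toℕ)
import Data.Fin as Fin
open import Data.Vec using (Vec; []; _∷_; zipWith; replicate; tabulate; lookup; concat)
open import Data.Product using (Σ; ∃; _×_; _,_)
open import Relation.Binary.PropositionalEquality using (_≡_; _≢_)

module _ (p : ℕ) ⦃ _ : NonZero p ⦄ where

  0p : Fin p
  0p = 0 mod p

  _+p_ : Fin p → Fin p → Fin p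
  a +p b = (toℕ a + toℕ b) mod p

  _*p_ : Fin p → Fin p → Fin p
  a *p b = (toℕ a * toℕ b) mod p

record FpSpace (p : ℕ) : Set₁ where
  field
    V   : Set
    ε   : V
    _⊕_ : V → V → V
    _·_ : Fin p → V → V

module _ {p : ℕ} ⦃ _ : NonZero p ⦄ (S : FpSpace p) where
  open FpSpace S

  lincomb : {t : ℕ} → (Fin t → Fin p) → (Fin t → V) → V
  lincomb {zero}  c w = ε
  lincomb {suc t} c w = (c Fin.zero · w Fin.zero) ⊕ lincomb (λ j → c (Fin.suc j)) (λ j → w (Fin.suc j))

  InSpan : {t : ℕ} → V → (Fin t → V) → Set
  InSpan v w = ∃ λ c → lincomb c w ≡ v

  LinIndep : {d : ℕ} → (Fin d → V) → Set
  LinIndep b = ∀ c → lincomb c b ≡ ε → ∀ k → c k ≡ 0p p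

  SpanDim : {t : ℕ} → (Fin t → V) → ℕ → Set
  SpanDim vs d = Σ (Fin d → V) λ b →
    (∀ k → InSpan (b k) vs) × (∀ i → InSpan (vs i) b) × LinIndep b

FpVec : (p : ℕ) ⦃ _ : NonZero p ⦄ → ℕ → FpSpace p
FpVec p n = record
  { V = Vec (Fin p) n
  ; ε = replicate n (0p p)
  ; _⊕_ = zipWith (_+p_ p)
  ; _·_ = λ a v → Data.Vec.map (_*p_ p a) v
  }

-- The field F_q, q = p^m, presented through a fixed F_p-basis:
-- elements are their coordinate vectors in F_p^m, addition is
-- coordinatewise, and the multiplication is any making it a field.

module _ (p m : ℕ) ⦃ _ : NonZero p ⦄ where

  Fq : Set
  Fq = Vec (Fin p) m

  0q : Fq
  0q = replicate m (0p p)

  _+q_ : Fq → Fq → Fq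
  _+q_ = zipWith (_+p_ p)

record FieldOn (p m : ℕ) ⦃ _ : NonZero p ⦄ : Set where
  field
    _*F_       : Fq p m → Fq p m → Fq p m
    1F         : Fq p m
    *-assoc    : ∀ x y z → (x *F y) *F z ≡ x *F (y *F z)
    *-comm     : ∀ x y → x *F y ≡ y *F x
    *-identityˡ : ∀ x → 1F *F x ≡ x
    distribˡ   : ∀ x y z → x *F (_+q_ p m y z) ≡ _+q_ p m (x *F y) (x *F z)
    1≢0        : 1F ≢ 0q p m
    inverse    : ∀ x → x ≢ 0q p m → ∃ λ y → x *F y ≡ 1F

module _ {p m : ℕ} ⦃ _ : NonZero p ⦄ (K : FieldOn p m) where
  open FieldOn K

  F : Set
  F = Fq p m

  _^F_ : F → ℕ → F
  x ^F zero  = 1F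
  x ^F suc k = x *F (x ^F k)

  sumF : ℕ → (ℕ → F) → F
  sumF zero    f = 0q p m
  sumF (suc n) f = _+q_ p m (sumF n f) (f n)

  -- G = (F_q[T]/(T^{r+1}))^* / F_q^*.  Every class has a unique
  -- representative with constant term 1, i.e. 1 + a_1 T + ... + a_r T^r;
  -- we represent it by (a_1, ..., a_r) : Vec F r.

  coeff : {r : ℕ} → Vec F r → ℕ → F
  coeff a zero = 1F
  coeff {zero}  a (suc k) = 0q p m
  coeff {suc r} (x ∷ a) (suc zero) = x
  coeff {suc r} (x ∷ a) (suc (suc k)) = coeff a (suc k)

  -- product modulo T^{r+1}; coefficient of T^k (1 ≤ k ≤ r) is
  -- Σ_{i=0}^{k} a_i b_{k-i}
  mulG : {r : ℕ} → Vec F r → Vec F r → Vec F r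
  mulG a b = tabulate λ j →
    sumF (suc (suc (toℕ j))) (λ i → coeff a i *F coeff b (suc (toℕ j) ∸ i))

  oneG : {r : ℕ} → Vec F r
  oneG {r} = replicate r (0q p m)

  powG : {r : ℕ} → Vec F r → ℕ → Vec F r
  powG g zero    = oneG
  powG g (suc k) = mulG g (powG g k)

  -- G as an F_p-vector space: "addition" is multiplication, scalar
  -- multiplication by u is the u-th power.
  GSpace : ℕ → FpSpace p
  GSpace r = record
    { V = Vec F r
    ; ε = oneG
    ; _⊕_ = mulG
    ; _·_ = λ u g → powG g (toℕ u)
    }

  onePlus : (r : ℕ) → F → Vec F r
  onePlus r α = tabulate λ { Fin.zero → α ; (Fin.suc _) → 0q p m }

  -- column of G_I belonging to α: (α, α^2, ..., α^r) stacked as a vector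
  -- in F_p^{rm} (each α^k written in the fixed basis, i.e. its coordinates)
  column : (r : ℕ) → F → Vec (Fin p) (r * m)
  column r α = concat (tabulate {n = r} λ k → α ^F suc (toℕ k))

{-# OPTIONS --safe #-}
-- For power series c with constant term 1, the logarithmic derivative T c′/c turns products into
-- sums.  Its coefficients of T, …, T^r, with alternating signs, therefore give an F_p-linear map
-- from G to F_q^r = F_p^{rm}, and it sends the class of 1 + αT to (α, α², …, α^r), the column of
-- G_I belonging to α.  The map is injective because c ⋆ (T c′/c) = T c′ determines k c_k from the
-- first k coefficients of T c′/c and c₀, …, c_{k-1}, and k is invertible in F_p for k ≤ r < p.
-- An injective linear map preserves the dimension of spans.
module Submission where

open import Defs
open import Algebra.Bundles using (CommutativeRing)
open import Algebra.Core using (Op₁; Op₂)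
open import Algebra.Structures using (IsAbelianGroup; IsCommutativeRing)
open import Algebra.Consequences.Propositional
  using (comm∧idˡ⇒id; comm∧invˡ⇒inv; comm∧distrˡ⇒distrʳ)
import Algebra.Definitions.RawMonoid as RawMonoidDefinitions
open import Data.Empty using (⊥-elim)
open import Data.Fin using (Fin; toℕ; fromℕ<)
import Data.Fin as Fin
open import Data.Fin.Properties using (toℕ-fromℕ<; toℕ-injective; toℕ<n)
import Data.Nat as ℕ
open import Data.Nat using (ℕ; zero; suc; _∸_; _≤_; _<_; z≤n; s≤s; s≤s⁻¹; NonZero; _≟_)
open import Data.Nat.DivMod using (_mod_; %-distribˡ-+; m%n%n≡m%n; m<n⇒m%n≡m; [m+n]%n≡m%n; m%n<n)
open import Data.Nat.Divisibility using (m%n≡0⇒n∣m; n∣m⇒m%n≡0; >⇒∤)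
open import Data.Nat.Primality using (Prime; euclidsLemma)
open import Data.Nat.Properties
  using (≤-refl; ≤-trans; <⇒≢; n<1+n; m<n⇒m<1+n; m≤n⇒m≤1+n; m≤n⇒m<n∨m≡n)
open import Data.Product using (_,_; proj₁; proj₂)
open import Function using (_∘_)
open import Function.Bundles using (_⇔_; mk⇔)
open import Data.Sum using (inj₁; inj₂)
open import Data.Vec using (Vec; []; _∷_; _++_; zipWith; replicate; map; concat; tabulate; lookup)
open import Data.Vec.Properties
  using (zipWith-assoc; zipWith-comm; zipWith-identityˡ; zipWith-inverseˡ; zipWith-++; map-const;
         ∷-injectiveˡ; ∷-injectiveʳ; ++-injective; tabulate-cong; lookup-replicate; lookup∘tabulate)
open import Relation.Binary.PropositionalEquality
open import Relation.Nullary using (yes; no; contradiction)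
open import Level using (0ℓ)

module _ {A : Set} {_∙_ : Op₂ A} {ε : A} {_⁻¹ : Op₁ A} where

  zipWith-isAbelianGroup : IsAbelianGroup _≡_ _∙_ ε _⁻¹ → ∀ l →
                           IsAbelianGroup _≡_ (zipWith {n = l} _∙_) (replicate l ε) (map _⁻¹)
  zipWith-isAbelianGroup G l = record
    { isGroup = record
      { isMonoid = record
        { isSemigroup = record
          { isMagma = record { isEquivalence = isEquivalence ; ∙-cong = cong₂ _ }
          ; assoc = zipWith-assoc assoc }
        ; identity = comm∧idˡ⇒id ∙ᵛ-comm (zipWith-identityˡ identityˡ) }
      ; inverse = comm∧invˡ⇒inv ∙ᵛ-comm (zipWith-inverseˡ inverseˡ)
      ; ⁻¹-cong = cong (map _⁻¹) }
    ; comm = ∙ᵛ-comm }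
    where
    open IsAbelianGroup G using (assoc; identityˡ; inverseˡ; comm)
    ∙ᵛ-comm : ∀ (u v : Vec A l) → zipWith _∙_ u v ≡ zipWith _∙_ v u
    ∙ᵛ-comm = zipWith-comm comm

infix 4 _≡[≤_]_
_≡[≤_]_ : {A : Set} → (ℕ → A) → ℕ → (ℕ → A) → Set
f ≡[≤ N ] g = ∀ i → i ≤ N → f i ≡ g i

≡[≤]-induction : ∀ {A : Set} {f g : ℕ → A} N → f 0 ≡ g 0 →
                 (∀ n → n < N → f ≡[≤ n ] g → f (suc n) ≡ g (suc n)) → f ≡[≤ N ] g
≡[≤]-induction zero base step .zero z≤n = base
≡[≤]-induction {f = f} {g} (suc N) base step = extend
  where
  agree : f ≡[≤ N ] g
  agree = ≡[≤]-induction N base (λ n n<N → step n (m<n⇒m<1+n n<N))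
  extend : f ≡[≤ suc N ] g
  extend i i≤1+N with m≤n⇒m<n∨m≡n i≤1+N
  ... | inj₁ i<1+N = agree i (s≤s⁻¹ i<1+N)
  ... | inj₂ refl  = step N (n<1+n N) agree

module _ {A : Set} where

  update : (ℕ → A) → ℕ → A → ℕ → A
  update f k x j with j ≟ k
  ... | yes _ = x
  ... | no  _ = f j

  update-≡ : ∀ f k x → update f k x k ≡ x
  update-≡ f k x with k ≟ k
  ... | yes _  = refl
  ... | no k≢k = contradiction refl k≢k

  update-≢ : ∀ f {k} x {j} → j ≢ k → update f k x j ≡ f j
  update-≢ f {k} x {j} j≢k with j ≟ k
  ... | yes j≡k = contradiction j≡k j≢k
  ... | no  _   = refl

module _ {A B : Set} where

  zipWith-map-self : ∀ {l} {f : A → B → A} {g : A → B} {h : A → A} → (∀ a → f a (g a) ≡ h a) →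
                     (v : Vec A l) → zipWith f v (map g v) ≡ map h v
  zipWith-map-self eq []      = refl
  zipWith-map-self eq (a ∷ v) = cong₂ _∷_ (eq a) (zipWith-map-self eq v)

  map≡replicate⇒≡replicate : ∀ {l} {f : A → B} {a₀ : A} {b₀ : B} → (∀ a → f a ≡ b₀ → a ≡ a₀) →
                             (v : Vec A l) → map f v ≡ replicate l b₀ → v ≡ replicate l a₀
  map≡replicate⇒≡replicate ker []      _  = refl
  map≡replicate⇒≡replicate ker (a ∷ v) eq =
    cong₂ _∷_ (ker a (∷-injectiveˡ eq)) (map≡replicate⇒≡replicate ker v (∷-injectiveʳ eq))

module _ {A : Set} where

  replicate-++ : ∀ m n (z : A) → replicate m z ++ replicate n z ≡ replicate (m ℕ.+ n) z
  replicate-++ zero    n z = refl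
  replicate-++ (suc m) n z = cong (z ∷_) (replicate-++ m n z)

  concat-tabulate-replicate : ∀ r m (z : A) →
                              concat (tabulate {n = r} (λ _ → replicate m z)) ≡ replicate (r ℕ.* m) z
  concat-tabulate-replicate zero    m z = refl
  concat-tabulate-replicate (suc r) m z =
    trans (cong (replicate m z ++_) (concat-tabulate-replicate r m z)) (replicate-++ m (r ℕ.* m) z)

  concat-tabulate-zipWith : ∀ {r m} (h : A → A → A) (f g : Fin r → Vec A m) →
    zipWith h (concat (tabulate f)) (concat (tabulate g)) ≡ concat (tabulate (λ k → zipWith h (f k) (g k)))
  concat-tabulate-zipWith {zero}  h f g = refl
  concat-tabulate-zipWith {suc r} h f g = trans (zipWith-++ h (f Fin.zero) _ (g Fin.zero) _)
    (cong (zipWith h (f Fin.zero) (g Fin.zero) ++_) (concat-tabulate-zipWith h (f ∘ Fin.suc) (g ∘ Fin.suc)))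

  concat-tabulate-injective : ∀ {r m} (f g : Fin r → Vec A m) →
                              concat (tabulate f) ≡ concat (tabulate g) → ∀ k → f k ≡ g k
  concat-tabulate-injective f g eq Fin.zero    = proj₁ (++-injective (f Fin.zero) (g Fin.zero) eq)
  concat-tabulate-injective f g eq (Fin.suc k) = concat-tabulate-injective (f ∘ Fin.suc) (g ∘ Fin.suc)
    (proj₂ (++-injective (f Fin.zero) (g Fin.zero) eq)) k

module _ {p : ℕ} ⦃ _ : NonZero p ⦄ where

  lincomb-cong : ∀ (U : FpSpace p) {t} (c : Fin t → Fin p) {w w′} →
                 (∀ j → w j ≡ w′ j) → lincomb U c w ≡ lincomb U c w′
  lincomb-cong U {zero}  c w≡w′ = refl
  lincomb-cong U {suc t} c w≡w′ = cong₂ (FpSpace._⊕_ U) (cong (FpSpace._·_ U (c Fin.zero)) (w≡w′ Fin.zero))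
                                        (lincomb-cong U (c ∘ Fin.suc) (w≡w′ ∘ Fin.suc))

  record IsLinear (S T : FpSpace p) (φ : FpSpace.V S → FpSpace.V T) : Set where
    private
      module S = FpSpace S
      module T = FpSpace T
    field
      ε-homo : φ S.ε ≡ T.ε
      ⊕-homo : ∀ x y → φ (x S.⊕ y) ≡ φ x T.⊕ φ y
      ·-homo : ∀ u x → φ (u S.· x) ≡ u T.· φ x

    lincomb-homo : ∀ {t} (c : Fin t → Fin p) w → φ (lincomb S c w) ≡ lincomb T c (φ ∘ w)
    lincomb-homo {zero}  c w = ε-homo
    lincomb-homo {suc t} c w =
      trans (⊕-homo _ _) (cong₂ T._⊕_ (·-homo _ _) (lincomb-homo (c ∘ Fin.suc) (w ∘ Fin.suc)))

  SpanDim-transport : ∀ {S T : FpSpace p} {φ} → IsLinear S T φ → (∀ x y → φ x ≡ φ y → x ≡ y) →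
                      ∀ {t d} {vs : Fin t → FpSpace.V S} {ws : Fin t → FpSpace.V T} →
                      (∀ i → φ (vs i) ≡ ws i) → SpanDim S vs d ⇔ SpanDim T ws d
  SpanDim-transport {S} {T} {φ} linear injective {vs = vs} {ws} φvs≡ws = mk⇔ forward backward
    where
    open IsLinear linear
    φvs≗ws : ∀ c → lincomb T c (φ ∘ vs) ≡ lincomb T c ws
    φvs≗ws c = lincomb-cong T c φvs≡ws

    forward : ∀ {d} → SpanDim S vs d → SpanDim T ws d
    forward (b , b∈vs , vs∈b , indep) =
      φ ∘ b ,
      (λ k → proj₁ (b∈vs k) ,
        trans (sym (φvs≗ws _)) (trans (sym (lincomb-homo _ vs)) (cong φ (proj₂ (b∈vs k))))) ,
      (λ i → proj₁ (vs∈b i) ,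
        trans (sym (lincomb-homo _ b)) (trans (cong φ (proj₂ (vs∈b i))) (φvs≡ws i))) ,
      (λ c eq → indep c (injective _ _ (trans (lincomb-homo c b) (trans eq (sym ε-homo)))))

    backward : ∀ {d} → SpanDim T ws d → SpanDim S vs d
    backward (b′ , b′∈ws , ws∈b′ , indep′) = b , (λ k → proj₁ (b′∈ws k) , refl) , vs∈b , indep
      where
      b : Fin _ → FpSpace.V S
      b k = lincomb S (proj₁ (b′∈ws k)) vs
      φb≡b′ : ∀ k → φ (b k) ≡ b′ k
      φb≡b′ k = trans (lincomb-homo _ vs) (trans (φvs≗ws _) (proj₂ (b′∈ws k)))
      φb≗b′ : ∀ c → lincomb T c (φ ∘ b) ≡ lincomb T c b′
      φb≗b′ c = lincomb-cong T c φb≡b′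
      vs∈b : ∀ i → InSpan S (vs i) b
      vs∈b i = proj₁ (ws∈b′ i) , injective _ _
        (trans (lincomb-homo _ b) (trans (φb≗b′ _) (trans (proj₂ (ws∈b′ i)) (sym (φvs≡ws i)))))
      indep : LinIndep S b
      indep c eq =
        indep′ c (trans (sym (φb≗b′ c)) (trans (sym (lincomb-homo c b)) (trans (cong φ eq) ε-homo)))

module ModularArithmetic (p : ℕ) ⦃ _ : NonZero p ⦄ where
  open import Data.Nat using (_+_; _*_; _%_; >-nonZero⁻¹)
  open import Data.Nat.Properties using (+-comm; +-assoc; m+[n∸m]≡n; <⇒≤)
  open ≡-Reasoning

  toℕ-mod : ∀ x → toℕ (x mod p) ≡ x % p
  toℕ-mod x = toℕ-fromℕ< (m%n<n x p)

  mod-cong : ∀ {x y} → x % p ≡ y % p → x mod p ≡ y mod p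
  mod-cong {x} {y} eq = toℕ-injective (trans (toℕ-mod x) (trans eq (sym (toℕ-mod y))))

  toℕ-mod-absorbˡ : ∀ x y → (toℕ (x mod p) + y) mod p ≡ (x + y) mod p
  toℕ-mod-absorbˡ x y = mod-cong (begin
    (toℕ (x mod p) + y) % p     ≡⟨ cong (λ z → (z + y) % p) (toℕ-mod x) ⟩
    (x % p + y) % p             ≡⟨ %-distribˡ-+ (x % p) y p ⟩
    (x % p % p + y % p) % p     ≡⟨ cong (λ z → (z + y % p) % p) (m%n%n≡m%n x p) ⟩
    (x % p + y % p) % p         ≡⟨ %-distribˡ-+ x y p ⟨
    (x + y) % p                 ∎)

  toℕ-mod-absorbʳ : ∀ x y → (x + toℕ (y mod p)) mod p ≡ (x + y) mod p
  toℕ-mod-absorbʳ x y = begin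
    (x + toℕ (y mod p)) mod p   ≡⟨ cong (_mod p) (+-comm x _) ⟩
    (toℕ (y mod p) + x) mod p   ≡⟨ toℕ-mod-absorbˡ y x ⟩
    (y + x) mod p               ≡⟨ cong (_mod p) (+-comm y x) ⟩
    (x + y) mod p               ∎

  toℕ-mod-inverse : (a : Fin p) → toℕ a mod p ≡ a
  toℕ-mod-inverse a = toℕ-injective (trans (toℕ-mod (toℕ a)) (m<n⇒m%n≡m (toℕ<n a)))

  -p_ : Fin p → Fin p
  -p a = (p ∸ toℕ a) mod p

  +p-comm : ∀ a b → _+p_ p a b ≡ _+p_ p b a
  +p-comm a b = cong (_mod p) (+-comm (toℕ a) (toℕ b))

  +p-assoc : ∀ a b c → _+p_ p (_+p_ p a b) c ≡ _+p_ p a (_+p_ p b c)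
  +p-assoc a b c = begin
    (toℕ ((toℕ a + toℕ b) mod p) + toℕ c) mod p  ≡⟨ toℕ-mod-absorbˡ (toℕ a + toℕ b) (toℕ c) ⟩
    (toℕ a + toℕ b + toℕ c) mod p                ≡⟨ cong (_mod p) (+-assoc (toℕ a) (toℕ b) (toℕ c)) ⟩
    (toℕ a + (toℕ b + toℕ c)) mod p              ≡⟨ toℕ-mod-absorbʳ (toℕ a) (toℕ b + toℕ c) ⟨
    (toℕ a + toℕ ((toℕ b + toℕ c) mod p)) mod p  ∎

  +p-identityˡ : ∀ a → _+p_ p (0p p) a ≡ a
  +p-identityˡ a = trans (toℕ-mod-absorbˡ 0 (toℕ a)) (toℕ-mod-inverse a)

  +p-inverseˡ : ∀ a → _+p_ p (-p a) a ≡ 0p p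
  +p-inverseˡ a = begin
    (toℕ ((p ∸ toℕ a) mod p) + toℕ a) mod p  ≡⟨ toℕ-mod-absorbˡ (p ∸ toℕ a) (toℕ a) ⟩
    (p ∸ toℕ a + toℕ a) mod p                ≡⟨ cong (_mod p) (+-comm (p ∸ toℕ a) (toℕ a)) ⟩
    (toℕ a + (p ∸ toℕ a)) mod p              ≡⟨ cong (_mod p) (m+[n∸m]≡n (<⇒≤ (toℕ<n a))) ⟩
    p mod p                                  ≡⟨ mod-cong ([m+n]%n≡m%n 0 p) ⟩
    0 mod p                                  ∎

  +p-isAbelianGroup : IsAbelianGroup _≡_ (_+p_ p) (0p p) -p_
  +p-isAbelianGroup = record
    { isGroup = record
      { isMonoid = record
        { isSemigroup = record
          { isMagma = record { isEquivalence = isEquivalence ; ∙-cong = cong₂ _ }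
          ; assoc = +p-assoc }
        ; identity = comm∧idˡ⇒id +p-comm +p-identityˡ }
      ; inverse = comm∧invˡ⇒inv +p-comm +p-inverseˡ
      ; ⁻¹-cong = cong -p_ }
    ; comm = +p-comm }

  _×ᵛ_ : ∀ {l} → ℕ → Vec (Fin p) l → Vec (Fin p) l
  _×ᵛ_ {l} = RawMonoidDefinitions._×_ (record
    { Carrier = Vec (Fin p) l ; _≈_ = _≡_ ; _∙_ = zipWith (_+p_ p) ; ε = replicate l (0p p) })

  ×ᵛ-map : ∀ {l} n (v : Vec (Fin p) l) → n ×ᵛ v ≡ map (λ a → (n * toℕ a) mod p) v
  ×ᵛ-map zero    v = sym (map-const v (0p p))
  ×ᵛ-map (suc n) v = begin
    zipWith (_+p_ p) v (n ×ᵛ v)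
      ≡⟨ cong (zipWith (_+p_ p) v) (×ᵛ-map n v) ⟩
    zipWith (_+p_ p) v (map (λ a → (n * toℕ a) mod p) v)
      ≡⟨ zipWith-map-self (λ a → toℕ-mod-absorbʳ (toℕ a) (n * toℕ a)) v ⟩
    map (λ a → (suc n * toℕ a) mod p) v
      ∎

  toℕ-0p : toℕ (0p p) ≡ 0
  toℕ-0p = trans (toℕ-mod 0) (m<n⇒m%n≡m (>-nonZero⁻¹ p))

  *-mod-torsionFree : Prime p → ∀ {k} → suc k < p → (a : Fin p) → (suc k * toℕ a) mod p ≡ 0p p → a ≡ 0p p
  *-mod-torsionFree pr {k} k<p a eq
    with euclidsLemma (suc k) (toℕ a) pr (m%n≡0⇒n∣m _ p (trans (sym (toℕ-mod _)) (trans (cong toℕ eq) toℕ-0p)))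
  ... | inj₁ p∣1+k = ⊥-elim (>⇒∤ k<p p∣1+k)
  ... | inj₂ p∣a   =
    toℕ-injective (trans (sym (m<n⇒m%n≡m (toℕ<n a))) (trans (n∣m⇒m%n≡0 _ p p∣a) (sym toℕ-0p)))

  ×ᵛ-torsionFree : Prime p → ∀ {k l} → suc k < p → (v : Vec (Fin p) l) →
                   suc k ×ᵛ v ≡ replicate l (0p p) → v ≡ replicate l (0p p)
  ×ᵛ-torsionFree pr {k} k<p v eq =
    map≡replicate⇒≡replicate (*-mod-torsionFree pr k<p) v (trans (sym (×ᵛ-map (suc k) v)) eq)

module PowerSeries {A : Set} {plus times : Op₂ A} {negate : Op₁ A} {0ᴬ 1ᴬ : A}
                   (isCommutativeRing : IsCommutativeRing _≡_ plus times negate 0ᴬ 1ᴬ) where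

  commutativeRing : CommutativeRing 0ℓ 0ℓ
  commutativeRing = record { isCommutativeRing = isCommutativeRing }

  open CommutativeRing commutativeRing
    using (_+_; _*_; -_; _-_; 0#; 1#; +-comm; +-assoc; +-identityˡ; +-identityʳ; -‿inverseˡ;
           *-comm; *-assoc; *-identityˡ; *-identityʳ; zeroˡ; zeroʳ; distribˡ; distribʳ;
           ring; semiring; commutativeSemiring; +-commutativeSemigroup; +-commutativeMonoid)
  open import Algebra.Properties.Ring ring
    using (+-cancelʳ; +-identityˡ-unique; //-rightDividesˡ; x∙y⁻¹≈ε⇒x≈y;
           -0#≈0#; -‿+-comm; -‿involutive; -‿distribʳ-*)
  open import Algebra.Properties.Semiring.Mult semiring using (_×_; ×-comm-*)
  open import Algebra.Properties.Semiring.Exp semiring using (_^_)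
  open import Algebra.Properties.CommutativeMonoid.Mult +-commutativeMonoid using (×-distrib-+)
  open import Algebra.Properties.CommutativeSemigroup +-commutativeSemigroup using (interchange; x∙yz≈y∙xz)
  open import Algebra.Solver.Ring.NaturalCoefficients.Default commutativeSemiring using (solve; _:+_; _:=_)
  open ≡-Reasoning

  shift : (ℕ → A) → ℕ → A
  shift f i = f (suc i)

  -- The Cauchy product: (f ⋆ g) n = Σ_{i ≤ n} f i * g (n ∸ i).
  infixl 7 _⋆_
  _⋆_ : (ℕ → A) → (ℕ → A) → ℕ → A
  (f ⋆ g) zero    = f 0 * g 0
  (f ⋆ g) (suc n) = f 0 * g (suc n) + (shift f ⋆ g) n

  -- The Euler operator θ = T d/dT.
  θ : (ℕ → A) → ℕ → A
  θ f n = n × f n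

  ⋆-cong : ∀ n {f f′ g g′} → f ≡[≤ n ] f′ → g ≡[≤ n ] g′ → (f ⋆ g) n ≡ (f′ ⋆ g′) n
  ⋆-cong zero    f≡ g≡ = cong₂ _*_ (f≡ 0 z≤n) (g≡ 0 z≤n)
  ⋆-cong (suc n) f≡ g≡ = cong₂ _+_ (cong₂ _*_ (f≡ 0 z≤n) (g≡ (suc n) ≤-refl))
    (⋆-cong n (λ i i≤n → f≡ (suc i) (s≤s i≤n)) (λ i i≤n → g≡ i (m≤n⇒m≤1+n i≤n)))

  ⋆-comm : ∀ n f g → (f ⋆ g) n ≡ (g ⋆ f) n
  ⋆-comm zero          f g = *-comm (f 0) (g 0)
  ⋆-comm (suc zero)    f g = trans (+-comm _ _) (cong₂ _+_ (*-comm (f 1) (g 0)) (*-comm (f 0) (g 1)))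
  ⋆-comm (suc (suc n)) f g = begin
    x + (shift f ⋆ g) (suc n)          ≡⟨ cong (x +_) (⋆-comm (suc n) (shift f) g) ⟩
    x + (y + (shift g ⋆ shift f) n)    ≡⟨ cong (λ z → x + (y + z)) (⋆-comm n (shift g) (shift f)) ⟩
    x + (y + (shift f ⋆ shift g) n)    ≡⟨ x∙yz≈y∙xz x y _ ⟩
    y + (f ⋆ shift g) (suc n)          ≡⟨ cong (y +_) (⋆-comm (suc n) f (shift g)) ⟩
    y + (shift g ⋆ f) (suc n)          ∎
    where
    x y : A
    x = f 0 * g (suc (suc n))
    y = g 0 * f (suc (suc n))

  ⋆-distribˡ-+ : ∀ n f g h → (f ⋆ (λ i → g i + h i)) n ≡ (f ⋆ g) n + (f ⋆ h) n
  ⋆-distribˡ-+ zero    f g h = distribˡ (f 0) (g 0) (h 0)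
  ⋆-distribˡ-+ (suc n) f g h =
    trans (cong₂ _+_ (distribˡ (f 0) _ _) (⋆-distribˡ-+ n (shift f) g h)) (interchange _ _ _ _)

  ⋆-distribʳ-+ : ∀ n f g h → ((λ i → f i + g i) ⋆ h) n ≡ (f ⋆ h) n + (g ⋆ h) n
  ⋆-distribʳ-+ zero    f g h = distribʳ (h 0) (f 0) (g 0)
  ⋆-distribʳ-+ (suc n) f g h =
    trans (cong₂ _+_ (distribʳ (h (suc n)) _ _) (⋆-distribʳ-+ n (shift f) (shift g) h)) (interchange _ _ _ _)

  ⋆-*ˡ : ∀ n x f g → ((λ i → x * f i) ⋆ g) n ≡ x * (f ⋆ g) n
  ⋆-*ˡ zero    x f g = *-assoc x (f 0) (g 0)
  ⋆-*ˡ (suc n) x f g =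
    trans (cong₂ _+_ (*-assoc x (f 0) _) (⋆-*ˡ n x (shift f) g)) (sym (distribˡ x _ _))

  ⋆-assoc : ∀ n f g h → ((f ⋆ g) ⋆ h) n ≡ (f ⋆ (g ⋆ h)) n
  ⋆-assoc zero    f g h = *-assoc (f 0) (g 0) (h 0)
  ⋆-assoc (suc n) f g h = begin
    (f 0 * g 0) * h (suc n) + (shift (f ⋆ g) ⋆ h) n
      ≡⟨ cong ((f 0 * g 0) * h (suc n) +_) (⋆-distribʳ-+ n (λ i → f 0 * shift g i) (shift f ⋆ g) h) ⟩
    (f 0 * g 0) * h (suc n) + (((λ i → f 0 * shift g i) ⋆ h) n + ((shift f ⋆ g) ⋆ h) n)
      ≡⟨ cong₂ (λ x y → (f 0 * g 0) * h (suc n) + (x + y)) (⋆-*ˡ n (f 0) (shift g) h) (⋆-assoc n (shift f) g h) ⟩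
    (f 0 * g 0) * h (suc n) + (f 0 * (shift g ⋆ h) n + (shift f ⋆ (g ⋆ h)) n)
      ≡⟨ +-assoc _ _ _ ⟨
    ((f 0 * g 0) * h (suc n) + f 0 * (shift g ⋆ h) n) + (shift f ⋆ (g ⋆ h)) n
      ≡⟨ cong (_+ (shift f ⋆ (g ⋆ h)) n) (trans (cong (_+ f 0 * (shift g ⋆ h) n) (*-assoc (f 0) (g 0) _))
                                               (sym (distribˡ (f 0) _ _))) ⟩
    f 0 * (g ⋆ h) (suc n) + (shift f ⋆ (g ⋆ h)) n
      ∎

  ⋆-zeroˡ : ∀ n g → ((λ _ → 0#) ⋆ g) n ≡ 0#
  ⋆-zeroˡ zero    g = zeroˡ (g 0)
  ⋆-zeroˡ (suc n) g = trans (cong₂ _+_ (zeroˡ _) (⋆-zeroˡ n g)) (+-identityˡ 0#)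

  ⋆-zeroʳ : ∀ n f → (f ⋆ (λ _ → 0#)) n ≡ 0#
  ⋆-zeroʳ n f = trans (⋆-comm n f _) (⋆-zeroˡ n f)

  θ-leibniz : ∀ n f g → (θ f ⋆ g) n + (f ⋆ θ g) n ≡ θ (f ⋆ g) n
  θ-leibniz zero    f g = trans (cong₂ _+_ (zeroˡ (g 0)) (zeroʳ (f 0))) (+-identityˡ 0#)
  θ-leibniz (suc n) f g = begin
    (0# * b + (shift (θ f) ⋆ g) n) + (a * (suc n × b) + G)
      ≡⟨ cong₂ (λ x y → (x + y) + (a * (suc n × b) + G)) (zeroˡ b) (⋆-distribʳ-+ n (shift f) (θ (shift f)) g) ⟩
    (0# + (C + E)) + (a * (suc n × b) + G)
      ≡⟨ cong₂ (λ x y → x + (y + G)) (+-identityˡ (C + E)) (×-comm-* (suc n) a b) ⟩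
    (C + E) + ((a * b + n × (a * b)) + G)
      ≡⟨ shuffle (a * b) (n × (a * b)) C E G ⟩
    (a * b + C) + (n × (a * b) + (E + G))
      ≡⟨ cong (λ x → (a * b + C) + (n × (a * b) + x)) (θ-leibniz n (shift f) g) ⟩
    (a * b + C) + (n × (a * b) + n × C)
      ≡⟨ cong ((a * b + C) +_) (×-distrib-+ (a * b) C n) ⟨
    suc n × (a * b + C)
      ∎
    where
    a b C E G : A
    a = f 0
    b = g (suc n)
    C = (shift f ⋆ g) n
    E = (θ (shift f) ⋆ g) n
    G = (shift f ⋆ θ g) n
    shuffle : ∀ w x y z u → (y + z) + ((w + x) + u) ≡ (w + y) + (x + (z + u))
    shuffle = solve 5 (λ w x y z u → (y :+ z) :+ ((w :+ x) :+ u) := (w :+ y) :+ (x :+ (z :+ u))) refl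

  ×-zeroʳ : ∀ n → n × 0# ≡ 0#
  ×-zeroʳ zero    = refl
  ×-zeroʳ (suc n) = trans (+-identityˡ (n × 0#)) (×-zeroʳ n)

  ×-injective : ∀ n {x y} → (∀ z → n × z ≡ 0# → z ≡ 0#) → n × x ≡ n × y → x ≡ y
  ×-injective n {x} {y} torsionFree eq = x∙y⁻¹≈ε⇒x≈y x y (torsionFree (x - y)
    (+-identityˡ-unique (n × (x - y)) (n × y) (begin
      n × (x - y) + n × y  ≡⟨ ×-distrib-+ (x - y) y n ⟨
      n × (x - y + y)      ≡⟨ cong (n ×_) (//-rightDividesˡ y x) ⟩
      n × x                ≡⟨ eq ⟩
      n × y                ∎)))

  TorsionFreeUpTo : ℕ → Set
  TorsionFreeUpTo N = ∀ k x → suc k ≤ N → suc k × x ≡ 0# → x ≡ 0#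

  alternate : ℕ → A → A
  alternate zero    x = x
  alternate (suc j) x = - alternate j x

  alternate-0# : ∀ j → alternate j 0# ≡ 0#
  alternate-0# zero    = refl
  alternate-0# (suc j) = trans (cong -_ (alternate-0# j)) -0#≈0#

  alternate-+ : ∀ j x y → alternate j (x + y) ≡ alternate j x + alternate j y
  alternate-+ zero    x y = refl
  alternate-+ (suc j) x y = trans (cong -_ (alternate-+ j x y)) (sym (-‿+-comm _ _))

  alternate-*ʳ : ∀ j x y → x * alternate j y ≡ alternate j (x * y)
  alternate-*ʳ zero    x y = refl
  alternate-*ʳ (suc j) x y = trans (sym (-‿distribʳ-* x _)) (cong -_ (alternate-*ʳ j x y))

  alternate-‿-comm : ∀ j x → alternate j (- x) ≡ - alternate j x
  alternate-‿-comm zero    x = refl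
  alternate-‿-comm (suc j) x = cong -_ (alternate-‿-comm j x)

  alternate-involutive : ∀ j x → alternate j (alternate j x) ≡ x
  alternate-involutive zero    x = refl
  alternate-involutive (suc j) x =
    trans (cong -_ (alternate-‿-comm j _)) (trans (-‿involutive _) (alternate-involutive j x))

  -- Course-of-values recursion: step n + 1 solves (c ⋆ L) (suc n) = θ c (suc n) for L (suc n).
  logDerivUpTo : (ℕ → A) → ℕ → ℕ → A
  logDerivUpTo c zero    = λ _ → 0#
  logDerivUpTo c (suc n) =
    update (logDerivUpTo c n) (suc n) (θ c (suc n) - (shift c ⋆ logDerivUpTo c n) n)

  -- For c 0 = 1, the coefficients of the logarithmic derivative T c′/c.
  logDeriv : (ℕ → A) → ℕ → A
  logDeriv c n = logDerivUpTo c n n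

  logDerivUpTo-stable : ∀ c n {k} → k ≤ n → logDerivUpTo c n k ≡ logDeriv c k
  logDerivUpTo-stable c zero    z≤n = refl
  logDerivUpTo-stable c (suc n) k≤1+n with m≤n⇒m<n∨m≡n k≤1+n
  ... | inj₁ k<1+n = trans (update-≢ _ _ (<⇒≢ k<1+n)) (logDerivUpTo-stable c n (s≤s⁻¹ k<1+n))
  ... | inj₂ refl  = refl

  logDeriv-suc : ∀ c n → logDeriv c (suc n) ≡ θ c (suc n) - (shift c ⋆ logDeriv c) n
  logDeriv-suc c n = trans (update-≡ (logDerivUpTo c n) (suc n) _)
    (cong (λ S → θ c (suc n) - S) (⋆-cong n (λ _ _ → refl) (λ _ i≤n → logDerivUpTo-stable c n i≤n)))

  module _ {c : ℕ → A} (c₀≡1 : c 0 ≡ 1#) where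

    c₀* : ∀ x → c 0 * x ≡ x
    c₀* x = trans (cong (_* x) c₀≡1) (*-identityˡ x)

    ⋆-logDeriv : ∀ n → (c ⋆ logDeriv c) n ≡ θ c n
    ⋆-logDeriv zero    = zeroʳ (c 0)
    ⋆-logDeriv (suc n) = begin
      c 0 * logDeriv c (suc n) + S               ≡⟨ cong (_+ S) (trans (c₀* _) (logDeriv-suc c n)) ⟩
      θ c (suc n) - S + S                        ≡⟨ //-rightDividesˡ S (θ c (suc n)) ⟩
      θ c (suc n)                                ∎
      where
      S : A
      S = (shift c ⋆ logDeriv c) n

    logDeriv-unique : ∀ N {L} → (∀ n → n ≤ N → (c ⋆ L) n ≡ θ c n) → L ≡[≤ N ] logDeriv c
    logDeriv-unique N {L} solves = ≡[≤]-induction N (trans (sym (c₀* (L 0))) (solves 0 z≤n)) step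
      where
      step : ∀ n → n < N → L ≡[≤ n ] logDeriv c → L (suc n) ≡ logDeriv c (suc n)
      step n n<N agree = begin
        L (suc n)                  ≡⟨ c₀* _ ⟨
        c 0 * L (suc n)            ≡⟨ +-cancelʳ S _ _ (begin
          c 0 * L (suc n) + S                       ≡⟨ cong (c 0 * L (suc n) +_) (⋆-cong n (λ _ _ → refl) agree) ⟨
          (c ⋆ L) (suc n)                           ≡⟨ solves (suc n) n<N ⟩
          θ c (suc n)                               ≡⟨ ⋆-logDeriv (suc n) ⟨
          c 0 * logDeriv c (suc n) + S              ∎) ⟩
        c 0 * logDeriv c (suc n)   ≡⟨ c₀* _ ⟩
        logDeriv c (suc n)         ∎
        where
        S : A
        S = (shift c ⋆ logDeriv c) n

  ⋆-logDeriv-+ : ∀ {a b} → a 0 ≡ 1# → b 0 ≡ 1# → ∀ n →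
                 ((a ⋆ b) ⋆ (λ i → logDeriv a i + logDeriv b i)) n ≡ θ (a ⋆ b) n
  ⋆-logDeriv-+ {a} {b} a₀≡1 b₀≡1 n = begin
    ((a ⋆ b) ⋆ (λ i → logDeriv a i + logDeriv b i)) n  ≡⟨ ⋆-distribˡ-+ n (a ⋆ b) (logDeriv a) (logDeriv b) ⟩
    ((a ⋆ b) ⋆ logDeriv a) n + ((a ⋆ b) ⋆ logDeriv b) n ≡⟨ cong₂ _+_ via-a via-b ⟩
    (θ a ⋆ b) n + (a ⋆ θ b) n                           ≡⟨ θ-leibniz n a b ⟩
    θ (a ⋆ b) n                                         ∎
    where
    via-a : ((a ⋆ b) ⋆ logDeriv a) n ≡ (θ a ⋆ b) n
    via-a = begin
      ((a ⋆ b) ⋆ logDeriv a) n  ≡⟨ ⋆-cong n (λ i _ → ⋆-comm i a b) (λ _ _ → refl) ⟩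
      ((b ⋆ a) ⋆ logDeriv a) n  ≡⟨ ⋆-assoc n b a (logDeriv a) ⟩
      (b ⋆ (a ⋆ logDeriv a)) n  ≡⟨ ⋆-cong n (λ _ _ → refl) (λ i _ → ⋆-logDeriv a₀≡1 i) ⟩
      (b ⋆ θ a) n               ≡⟨ ⋆-comm n b (θ a) ⟩
      (θ a ⋆ b) n               ∎
    via-b : ((a ⋆ b) ⋆ logDeriv b) n ≡ (a ⋆ θ b) n
    via-b = trans (⋆-assoc n a b (logDeriv b)) (⋆-cong n (λ _ _ → refl) (λ i _ → ⋆-logDeriv b₀≡1 i))

  logDeriv-⋆ : ∀ {a b} → a 0 ≡ 1# → b 0 ≡ 1# → ∀ N {c} → c ≡[≤ N ] a ⋆ b →
               (λ i → logDeriv a i + logDeriv b i) ≡[≤ N ] logDeriv c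
  logDeriv-⋆ {a} {b} a₀≡1 b₀≡1 N {c} c≡ab = logDeriv-unique c₀≡1 N solves
    where
    c₀≡1 : c 0 ≡ 1#
    c₀≡1 = trans (c≡ab 0 z≤n) (trans (cong₂ _*_ a₀≡1 b₀≡1) (*-identityˡ 1#))
    solves : ∀ n → n ≤ N → (c ⋆ (λ i → logDeriv a i + logDeriv b i)) n ≡ θ c n
    solves n n≤N = begin
      (c ⋆ (λ i → logDeriv a i + logDeriv b i)) n
        ≡⟨ ⋆-cong n (λ i i≤n → c≡ab i (≤-trans i≤n n≤N)) (λ _ _ → refl) ⟩
      ((a ⋆ b) ⋆ (λ i → logDeriv a i + logDeriv b i)) n  ≡⟨ ⋆-logDeriv-+ a₀≡1 b₀≡1 n ⟩
      θ (a ⋆ b) n                                        ≡⟨ cong (n ×_) (c≡ab n n≤N) ⟨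
      θ c n                                              ∎

  logDeriv-1 : ∀ c → c 0 ≡ 1# → (∀ j → c (suc j) ≡ 0#) → ∀ n → logDeriv c n ≡ 0#
  logDeriv-1 c c₀≡1 c₊≡0 n = sym (logDeriv-unique c₀≡1 n solves n ≤-refl)
    where
    solves : ∀ k → k ≤ n → (c ⋆ (λ _ → 0#)) k ≡ θ c k
    solves zero    _ = ⋆-zeroʳ 0 c
    solves (suc k) _ = trans (⋆-zeroʳ (suc k) c) (sym (trans (cong (suc k ×_) (c₊≡0 k)) (×-zeroʳ (suc k))))

  logDeriv-1+αT : ∀ {c α} → c 0 ≡ 1# → c 1 ≡ α → (∀ j → c (suc (suc j)) ≡ 0#) →
                  ∀ j → logDeriv c (suc j) ≡ alternate j (α ^ suc j)
  logDeriv-1+αT {c} {α} c₀≡1 c₁≡α c₊₊≡0 j = sym (logDeriv-unique c₀≡1 (suc j) {L} solves (suc j) ≤-refl)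
    where
    L : ℕ → A
    L zero    = 0#
    L (suc j) = alternate j (α ^ suc j)
    solves : ∀ n → n ≤ suc j → (c ⋆ L) n ≡ θ c n
    solves zero          _ = zeroʳ (c 0)
    solves (suc zero)    _ = begin
      c 0 * (α * 1#) + c 1 * 0#   ≡⟨ cong₂ _+_ (trans (c₀* {c} c₀≡1 _) (*-identityʳ α)) (zeroʳ (c 1)) ⟩
      α + 0#                      ≡⟨ cong (_+ 0#) c₁≡α ⟨
      θ c 1                       ∎
    solves (suc (suc n)) _ = begin
      c 0 * - X + (c 1 * Y + (shift (shift c) ⋆ L) n)  ≡⟨ cong₂ (λ x y → x + (c 1 * Y + y)) (c₀* {c} c₀≡1 _) tail≡0 ⟩
      - X + (c 1 * Y + 0#)                             ≡⟨ cong (λ x → - X + x) (trans (+-identityʳ _) c₁Y≡X) ⟩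
      - X + X                                          ≡⟨ -‿inverseˡ X ⟩
      0#                                               ≡⟨ ×-zeroʳ (suc (suc n)) ⟨
      suc (suc n) × 0#                                 ≡⟨ cong (suc (suc n) ×_) (c₊₊≡0 n) ⟨
      θ c (suc (suc n))                                ∎
      where
      X Y : A
      X = alternate n (α ^ suc (suc n))
      Y = alternate n (α ^ suc n)
      tail≡0 : (shift (shift c) ⋆ L) n ≡ 0#
      tail≡0 = trans (⋆-cong n (λ i _ → c₊₊≡0 i) (λ _ _ → refl)) (⋆-zeroˡ n L)
      c₁Y≡X : c 1 * Y ≡ X
      c₁Y≡X = trans (cong (_* Y) c₁≡α) (alternate-*ʳ n α _)

  logDeriv-injective : ∀ N {a b} → TorsionFreeUpTo N → a 0 ≡ 1# → b 0 ≡ 1# →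
                       logDeriv a ≡[≤ N ] logDeriv b → a ≡[≤ N ] b
  logDeriv-injective N {a} {b} torsionFree a₀≡1 b₀≡1 La≡Lb = ≡[≤]-induction N (trans a₀≡1 (sym b₀≡1)) step
    where
    step : ∀ n → n < N → a ≡[≤ n ] b → a (suc n) ≡ b (suc n)
    step n n<N a≡b = ×-injective (suc n) (λ z → torsionFree n z n<N) (begin
      suc n × a (suc n)                       ≡⟨ ⋆-logDeriv a₀≡1 (suc n) ⟨
      (a ⋆ logDeriv a) (suc n)                ≡⟨ ⋆-comm (suc n) a (logDeriv a) ⟩
      0# * a (suc n) + (shift (logDeriv a) ⋆ a) n
        ≡⟨ cong₂ _+_ (trans (zeroˡ _) (sym (zeroˡ _)))
                 (⋆-cong n (λ i i≤n → La≡Lb (suc i) (≤-trans (s≤s i≤n) n<N)) a≡b) ⟩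
      0# * b (suc n) + (shift (logDeriv b) ⋆ b) n
                                              ≡⟨ ⋆-comm (suc n) b (logDeriv b) ⟨
      (b ⋆ logDeriv b) (suc n)                ≡⟨ ⋆-logDeriv b₀≡1 (suc n) ⟩
      suc n × b (suc n)                       ∎)

module FiniteField {p m : ℕ} ⦃ _ : NonZero p ⦄ (K : FieldOn p m) where
  open ModularArithmetic p
  open FieldOn K using (_*F_; 1F; *-comm; *-assoc; *-identityˡ; distribˡ)

  isCommutativeRing : IsCommutativeRing _≡_ (_+q_ p m) _*F_ (map -p_) (0q p m) 1F
  isCommutativeRing = record
    { isRing = record
      { +-isAbelianGroup = zipWith-isAbelianGroup +p-isAbelianGroup m
      ; *-cong = cong₂ _
      ; *-assoc = *-assoc
      ; *-identity = comm∧idˡ⇒id *-comm *-identityˡ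
      ; distrib = distribˡ , comm∧distrˡ⇒distrʳ *-comm distribˡ }
    ; *-comm = *-comm }

  open PowerSeries isCommutativeRing public
  open CommutativeRing commutativeRing using (_+_; _*_; 0#; 1#; +-comm; +-assoc; +-identityˡ; semiring)
  open import Algebra.Properties.Semiring.Exp semiring using (_^_)

  torsionFree : Prime p → ∀ {N} → N < p → TorsionFreeUpTo N
  torsionFree pr N<p k x k<N = ×ᵛ-torsionFree pr (≤-trans (s≤s k<N) N<p) x

  open ≡-Reasoning

  sumF-first : ∀ n f → sumF K (suc n) f ≡ f 0 + sumF K n (f ∘ suc)
  sumF-first zero    f = +-comm 0# (f 0)
  sumF-first (suc n) f = trans (cong (_+ f (suc n)) (sumF-first n f)) (+-assoc (f 0) _ _)

  sumF-⋆ : ∀ n f g → sumF K (suc n) (λ i → f i * g (n ∸ i)) ≡ (f ⋆ g) n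
  sumF-⋆ zero    f g = +-identityˡ _
  sumF-⋆ (suc n) f g = trans (sumF-first (suc n) _) (cong (f 0 * g (suc n) +_) (sumF-⋆ n (shift f) g))

  coeff-tabulate : ∀ {r} (f : Fin r → F K) {j} (j<r : j < r) → coeff K (tabulate f) (suc j) ≡ f (fromℕ< j<r)
  coeff-tabulate {suc r} f {zero}  _         = refl
  coeff-tabulate {suc r} f {suc j} (s≤s j<r) = coeff-tabulate (f ∘ Fin.suc) j<r

  coeff-zeros : ∀ {r} (v : Vec (F K) r) → (∀ i → lookup v i ≡ 0#) → ∀ j → coeff K v (suc j) ≡ 0#
  coeff-zeros []      _     j       = refl
  coeff-zeros (a ∷ v) v≡0 zero    = v≡0 Fin.zero
  coeff-zeros (a ∷ v) v≡0 (suc j) = coeff-zeros v (v≡0 ∘ Fin.suc) j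

  coeff-injective : ∀ {r} (x y : Vec (F K) r) →
                    (∀ j → j < r → coeff K x (suc j) ≡ coeff K y (suc j)) → x ≡ y
  coeff-injective []      []      _   = refl
  coeff-injective (a ∷ x) (b ∷ y) x≡y =
    cong₂ _∷_ (x≡y 0 (s≤s z≤n)) (coeff-injective x y (λ j j<r → x≡y (suc j) (s≤s j<r)))

  coeff-mulG : ∀ {r} (x y : Vec (F K) r) → coeff K (mulG K x y) ≡[≤ r ] coeff K x ⋆ coeff K y
  coeff-mulG x y zero    _   = sym (*-identityˡ 1#)
  coeff-mulG x y (suc j) j<r = begin
    coeff K (mulG K x y) (suc j)     ≡⟨ coeff-tabulate _ j<r ⟩
    convolution (toℕ (fromℕ< j<r))   ≡⟨ cong convolution (toℕ-fromℕ< j<r) ⟩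
    convolution j                    ≡⟨ sumF-⋆ (suc j) (coeff K x) (coeff K y) ⟩
    (coeff K x ⋆ coeff K y) (suc j)  ∎
    where
    convolution : ℕ → F K
    convolution t = sumF K (suc (suc t)) (λ i → coeff K x i * coeff K y (suc t ∸ i))

  ^≡^F : ∀ x n → x ^ n ≡ _^F_ K x n
  ^≡^F x zero    = refl
  ^≡^F x (suc n) = cong (x *_) (^≡^F x n)

  -- Block k of logDerivVec r x is (-1)^k times the coefficient of T^{k+1} in the logarithmic
  -- derivative of 1 + x₁T + … + x_rT^r; the sign makes the class of 1 + αT go to (α, α², …, α^r).
  logDerivBlock : ∀ {r} → Vec (F K) r → Fin r → F K
  logDerivBlock x k = alternate (toℕ k) (logDeriv (coeff K x) (suc (toℕ k)))

  logDerivVec : ∀ r → Vec (F K) r → Vec (Fin p) (r ℕ.* m)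
  logDerivVec r x = concat (tabulate (logDerivBlock x))

  logDerivBlock-oneG : ∀ {r} (k : Fin r) → logDerivBlock (oneG K {r}) k ≡ 0#
  logDerivBlock-oneG {r} k =
    trans (cong (alternate (toℕ k)) (logDeriv-1 c refl c₊≡0 (suc (toℕ k)))) (alternate-0# (toℕ k))
    where
    c : ℕ → F K
    c = coeff K (oneG K {r})
    c₊≡0 : ∀ j → c (suc j) ≡ 0#
    c₊≡0 = coeff-zeros (oneG K {r}) (λ i → lookup-replicate i 0#)

  logDerivBlock-mulG : ∀ {r} (x y : Vec (F K) r) k →
                       logDerivBlock (mulG K x y) k ≡ logDerivBlock x k + logDerivBlock y k
  logDerivBlock-mulG {r} x y k = trans
    (cong (alternate (toℕ k)) (sym (logDeriv-⋆ refl refl r (coeff-mulG x y) (suc (toℕ k)) (toℕ<n k))))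
    (alternate-+ (toℕ k) _ _)

  logDerivVec-oneG : ∀ r → logDerivVec r (oneG K) ≡ replicate (r ℕ.* m) (0p p)
  logDerivVec-oneG r =
    trans (cong (concat {n = r}) (tabulate-cong logDerivBlock-oneG)) (concat-tabulate-replicate r m (0p p))

  logDerivVec-mulG : ∀ r x y →
                     logDerivVec r (mulG K x y) ≡ zipWith (_+p_ p) (logDerivVec r x) (logDerivVec r y)
  logDerivVec-mulG r x y = trans (cong (concat {n = r}) (tabulate-cong (logDerivBlock-mulG x y)))
    (sym (concat-tabulate-zipWith (_+p_ p) (logDerivBlock x) (logDerivBlock y)))

  logDerivVec-powG : ∀ r n g → logDerivVec r (powG K g n) ≡ n ×ᵛ logDerivVec r g
  logDerivVec-powG r zero    g = logDerivVec-oneG r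
  logDerivVec-powG r (suc n) g =
    trans (logDerivVec-mulG r g (powG K g n))
          (cong (zipWith (_+p_ p) (logDerivVec r g)) (logDerivVec-powG r n g))

  logDerivVec-injective : Prime p → ∀ {r} → r < p → ∀ x y → logDerivVec r x ≡ logDerivVec r y → x ≡ y
  logDerivVec-injective pr {r} r<p x y eq = coeff-injective x y (λ j j<r → coeff-agree (suc j) j<r)
    where
    block-agree : ∀ k → logDeriv (coeff K x) (suc (toℕ k)) ≡ logDeriv (coeff K y) (suc (toℕ k))
    block-agree k = begin
      logDeriv (coeff K x) (suc (toℕ k))               ≡⟨ alternate-involutive (toℕ k) _ ⟨
      alternate (toℕ k) (logDerivBlock x k)
        ≡⟨ cong (alternate (toℕ k)) (concat-tabulate-injective (logDerivBlock x) (logDerivBlock y) eq k) ⟩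
      alternate (toℕ k) (logDerivBlock y k)            ≡⟨ alternate-involutive (toℕ k) _ ⟩
      logDeriv (coeff K y) (suc (toℕ k))               ∎
    logDeriv-agree : logDeriv (coeff K x) ≡[≤ r ] logDeriv (coeff K y)
    logDeriv-agree zero    _   = refl
    logDeriv-agree (suc j) j<r =
      subst (λ t → logDeriv (coeff K x) (suc t) ≡ logDeriv (coeff K y) (suc t)) (toℕ-fromℕ< j<r)
            (block-agree (fromℕ< j<r))
    coeff-agree : coeff K x ≡[≤ r ] coeff K y
    coeff-agree = logDeriv-injective r (torsionFree pr r<p) refl refl logDeriv-agree

  logDerivVec-onePlus : ∀ r α → logDerivVec (suc r) (onePlus K (suc r) α) ≡ column K (suc r) α
  logDerivVec-onePlus r α = cong (concat {n = suc r}) (tabulate-cong λ k → begin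
    alternate (toℕ k) (logDeriv c (suc (toℕ k)))
      ≡⟨ cong (alternate (toℕ k)) (logDeriv-1+αT refl refl c₊₊≡0 (toℕ k)) ⟩
    alternate (toℕ k) (alternate (toℕ k) (α ^ suc (toℕ k)))
      ≡⟨ alternate-involutive (toℕ k) _ ⟩
    α ^ suc (toℕ k)
      ≡⟨ ^≡^F α (suc (toℕ k)) ⟩
    _^F_ K α (suc (toℕ k))
      ∎)
    where
    c : ℕ → F K
    c = coeff K (onePlus K (suc r) α)
    c₊₊≡0 : ∀ j → c (suc (suc j)) ≡ 0#
    c₊₊≡0 = coeff-zeros {r} (tabulate λ _ → 0#) (lookup∘tabulate _)

  logDerivVec-isLinear : ∀ r → IsLinear (GSpace K r) (FpVec p (r ℕ.* m)) (logDerivVec r)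
  logDerivVec-isLinear r = record
    { ε-homo = logDerivVec-oneG r
    ; ⊕-homo = logDerivVec-mulG r
    ; ·-homo = λ u g → trans (logDerivVec-powG r (toℕ u) g) (×ᵛ-map (toℕ u) (logDerivVec r g))
    }

open import Data.Nat using (_*_)
open import Function.Definitions using (Injective)

lemma4p1 : (p m : ℕ) ⦃ _ : NonZero p ⦄ → Prime p → (K : FieldOn p m) →
           (r : ℕ) → 1 ≤ r → r < p →
           (t : ℕ) (α : Fin t → Fq p m) → Injective _≡_ _≡_ α →
           (∀ i → α i ≢ 0q p m) →
           SpanDim (GSpace K r) (λ i → onePlus K r (α i)) (r * m)
             ⇔ SpanDim (FpVec p (r * m)) (λ i → column K r (α i)) (r * m)
lemma4p1 p m pr K (suc r) (s≤s z≤n) r<p t α _ _ =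
  SpanDim-transport (logDerivVec-isLinear (suc r)) (logDerivVec-injective pr r<p)
                    (λ i → logDerivVec-onePlus r (α i))
  where open FiniteField K
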